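{- Let $\mathcal C\subseteq 2^{[n]}$ be an intersection-complete neural code and $\mathcal I\subseteq\mathcal C$ an isolated subset with minimal element $\mu$. Then $\mathcal C_{[\mathcal I]}=\{\mu\}\cup(\mathcal C\setminus\mathcal I)\cup(\mathcal I)_\alpha$ covers $\mathcal C$ in $\mathbf{P}_{\mathbf{Code}}$.
   Context: A neural code is a set $\mathcal C\subseteq 2^{[n]}$ containing $\varnothing$. For $\sigma\subseteq[n]$, the trunk $\mathrm{Tk}_{\mathcal C}(\sigma)=\{\tau\in\mathcal C:\sigma\subseteq\tau\}$; a trunk is proper if nonempty and not equal to $\mathcal C$. A morphism $f:\mathcal C\to\mathcal D$ is a function such that the preimage of every proper trunk in $\mathcal D$ is a proper trunk in $\mathcal C$; an isomorphism is a bijective morphism whose inverse is a morphism. Write $\mathcal D\le\mathcal C$ if there is a surjective morphism $\mathcal C\to\mathcal D$; this partial order on isomorphism classes is $\mathbf{P}_{\mathbf{Code}}$, and $\mathcal C$ covers $\mathcal D$ if $\mathcal D<\mathcal C$ with no $\mathcal E$ satisfying $\mathcal D<\mathcal E<\mathcal C$. A code is intersection-complete if closed under pairwise intersection. If $\mathcal C$ is intersection-complete, $\mathcal I\subseteq\mathcal C$ is isolated if it is nonempty and closed under pairwise intersection (so it has a least element $\mu$), and there are no $\sigma\in\mathcal C\setminus\mathcal I$, $\tau\in\mathcal I\setminus\{\mu\}$ with $\tau\subseteq\sigma$. Here $\alpha\notin[n]$ is a new neuron and $(S)_\alpha=\{c\cup\{\alpha\}:c\in S\}$. -}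

module Defs where

open import Data.Nat using (ℕ; suc)
open import Data.Bool using (Bool; true; false; T; _∧_; _∨_; not)
open import Data.Bool.Properties using (∧-identityʳ) renaming (_≟_ to _≟ᵇ_)
open import Data.Fin.Subset using (Subset; _⊆_; _∩_; ⊥; inside; outside)
open import Data.Vec using (_∷_)
open import Data.Fin.Subset.Properties using (⊆-antisym; ⊥⊆)
open import Data.Vec.Properties using (≡-dec)
open import Data.Product using (Σ; ∃; ∃-syntax; _×_; _,_; proj₁)
open import Relation.Nullary using (¬_; does; yes; no; contradiction)
open import Relation.Binary.PropositionalEquality using (_≡_; _≢_; refl; sym; subst)
open import Function.Bundles using (_⇔_)

record Code (n : ℕ) : Set where
  field
    mem      : Subset n → Bool
    hasEmpty : T (mem ⊥)
open Code public

Elem : ∀ {n} → Code n → Set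
Elem {n} C = Σ (Subset n) (λ c → T (mem C c))

ProperTrunk : ∀ {n} → Code n → Subset n → Set
ProperTrunk C σ = (Σ (Elem C) λ c → σ ⊆ proj₁ c) × ¬ (∀ (c : Elem C) → σ ⊆ proj₁ c)

IsMorphism : ∀ {n m} (C : Code n) (D : Code m) → (Elem C → Elem D) → Set
IsMorphism C D f =
  ∀ (σ : Subset _) → ProperTrunk D σ →
    ∃[ τ ] (ProperTrunk C τ × (∀ (c : Elem C) → (τ ⊆ proj₁ c) ⇔ (σ ⊆ proj₁ (f c))))

Surjective : ∀ {n m} (C : Code n) (D : Code m) → (Elem C → Elem D) → Set
Surjective C D f = ∀ (d : Elem D) → ∃[ c ] (proj₁ (f c) ≡ proj₁ d)

Iso : ∀ {n m} → Code n → Code m → Set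
Iso C D =
  Σ (Elem C → Elem D) λ f → Σ (Elem D → Elem C) λ g →
    IsMorphism C D f × IsMorphism D C g ×
    (∀ c → proj₁ (g (f c)) ≡ proj₁ c) × (∀ d → proj₁ (f (g d)) ≡ proj₁ d)

_≤ᶜ_ : ∀ {m n} → Code m → Code n → Set
D ≤ᶜ C = Σ (Elem C → Elem D) λ f → IsMorphism C D f × Surjective C D f

_<ᶜ_ : ∀ {m n} → Code m → Code n → Set
D <ᶜ C = D ≤ᶜ C × ¬ Iso C D

Covers : ∀ {n m} → Code n → Code m → Set
Covers C D = D <ᶜ C × (∀ (k : ℕ) (E : Code k) → ¬ (D <ᶜ E × E <ᶜ C))

IntersectionComplete : ∀ {n} → Code n → Set
IntersectionComplete C =
  ∀ c d → T (mem C c) → T (mem C d) → T (mem C (c ∩ d))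

IsIsolated : ∀ {n} → Code n → (Subset n → Bool) → Subset n → Set
IsIsolated C I μ =
  (∀ c → T (I c) → T (mem C c)) ×
  (∃[ c ] T (I c)) ×
  (∀ c d → T (I c) → T (I d) → T (I (c ∩ d))) ×
  (T (I μ) × (∀ c → T (I c) → μ ⊆ c)) ×
  (¬ (∃[ σ ] ∃[ τ ] (T (mem C σ) × ¬ T (I σ) × T (I τ) × τ ≢ μ × τ ⊆ σ)))

-- C_[I] = {μ} ∪ (C ∖ I) ∪ (I)_α on n+1 neurons; the new neuron α is index zero
-- (c ∪ {α} = inside ∷ c, and a codeword without α is outside ∷ c).
extendMem : ∀ {n} → Code n → (Subset n → Bool) → Subset n → Subset (suc n) → Bool
extendMem C I μ (true  ∷ c) = I c
extendMem C I μ (false ∷ c) = does (≡-dec _≟ᵇ_ c μ) ∨ (mem C c ∧ not (I c))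

extendEmpty : ∀ {n} (C : Code n) (I : Subset n → Bool) (μ : Subset n) →
  IsIsolated C I μ → T (extendMem C I μ ⊥)
extendEmpty {n} C I μ (_ , _ , _ , (_ , least) , _) = go (I ⊥) refl
  where
  go : (b : Bool) → I ⊥ ≡ b → T (extendMem C I μ ⊥)
  go true  e with ≡-dec _≟ᵇ_ (⊥ {n}) μ
  ... | yes _  = _
  ... | no ne  = contradiction (sym (⊆-antisym (least ⊥ (subst T (sym e) _)) ⊥⊆)) ne
  go false e with does (≡-dec _≟ᵇ_ (⊥ {n}) μ)
  ... | true  = _
  ... | false rewrite e = subst T (sym (∧-identityʳ (mem C ⊥))) (hasEmpty C)

extend : ∀ {n} (C : Code n) (I : Subset n → Bool) (μ : Subset n) →
  IsIsolated C I μ → Code (suc n)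
extend C I μ iso = record { mem = extendMem C I μ ; hasEmpty = extendEmpty C I μ iso }

{-# OPTIONS --safe #-}

-- The invariant is the number of proper trunks. A surjective morphism f : X → Y pulls
-- distinct proper trunks of Y back to distinct proper trunks of X, so the trunk count grows
-- along ≤ᶜ. If X has no more proper trunks than Y, every proper trunk of X is such a
-- pullback; this makes f injective and its inverse a morphism, so f is an isomorphism.
-- Deleting the new neuron α is a surjective morphism C_[I] → C merging μ and μ ∪ {α}, hence
-- C_[I] has more proper trunks than C. Apart from Tk(α) = (I)_α, every proper trunk of C_[I]
-- is pulled back from C (this is where the isolation of I enters), so C_[I] has exactly one
-- more. A code strictly between C and C_[I] would need a trunk count strictly between two
-- consecutive numbers.

module Submission where

open import Defs
open import Data.Nat using (ℕ; zero; suc; _+_; _≤_; _<_)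
open import Data.Nat.Properties using (≤-trans; <⇒≱; _≤?_; ≰⇒>)
open import Data.Bool using (Bool; true; false; T; if_then_else_; _∧_)
open import Data.Bool.Properties using (T-irrelevant; T?; T-≡; T-∧) renaming (_≟_ to _≟ᵇ_)
open import Data.Unit using (⊤; tt)
open import Data.Empty using (⊥-elim)
open import Data.Fin using (Fin)
open import Data.Fin.Properties using (+↔⊎; 0↔⊥; 1↔⊤; injective⇒≤; any?)
open import Data.Fin.Subset using (Subset; inside; outside; _∈_; _⊆_; _⊂_; _∩_)
open import Data.Fin.Subset.Properties
  using (anySubset?; _∈?_; _⊆?_; ⊆-refl; ⊆-trans; ⊆-antisym; in⊆in; in⊆in-⇔; out⊆-⇔; drop-∷-⊆;
         p∩q⊆p; x∈p∩q⁺; x∈p∩q⁻)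
open import Data.Fin.Subset.Induction using (⊂-wellFounded)
open import Induction.WellFounded using (Acc; acc)
open import Data.Vec using ([]; _∷_; tabulate; here)
open import Data.Vec.Properties using (≡-dec; lookup∘tabulate; []=⇒lookup; lookup⇒[]=)
open import Data.Product using (Σ; ∃; ∃-syntax; _×_; _,_; proj₁; proj₂)
open import Data.Sum using (_⊎_; inj₁; inj₂; [_,_]′)
open import Data.Sum.Properties using (inj₂-injective)
open import Data.Sum.Function.Propositional using (_⊎-↔_)
open import Function using (_∘_; id; const)
open import Function.Bundles using (Injection; _↣_; _↔_; mk↔ₛ′; mk↣; _⇔_; mk⇔; Equivalence)
open import Function.Construct.Symmetry using (⇔-sym)
open import Function.Construct.Composition using (_↣-∘_; _↔-∘_; _⇔-∘_)
open import Function.Properties.Inverse using (↔-sym; ↔⇒↣)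
open import Relation.Nullary using (Dec; yes; no; ¬_)
open import Relation.Nullary.Decidable
  using (⌊_⌋; map′; ¬?; _×-dec_; _→-dec_; decidable-stable; toWitness; fromWitness)
open import Relation.Binary.PropositionalEquality using (_≡_; _≢_; refl; sym; trans; cong; subst)

Sub : ∀ {n} → (Subset n → Bool) → Set
Sub {n} P = Σ (Subset n) (T ∘ P)

Sub-≡ : ∀ {n} {P : Subset n → Bool} {a b : Sub P} → proj₁ a ≡ proj₁ b → a ≡ b
Sub-≡ {a = s , p} {b = .s , q} refl = cong (s ,_) (T-irrelevant p q)

count : ∀ {n} → (Subset n → Bool) → ℕ
count {zero}  P = if P [] then 1 else 0
count {suc n} P = count (P ∘ (inside ∷_)) + count (P ∘ (outside ∷_))

T↔Fin : ∀ b → T b ↔ Fin (if b then 1 else 0)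
T↔Fin true  = ↔-sym 1↔⊤
T↔Fin false = ↔-sym 0↔⊥

Sub↔T : (P : Subset 0 → Bool) → Sub P ↔ T (P [])
Sub↔T P = mk↔ₛ′ (λ { ([] , p) → p }) ([] ,_) (λ _ → refl) (λ { ([] , p) → refl })

Sub↔⊎ : ∀ {n} (P : Subset (suc n) → Bool) →
        Sub P ↔ (Sub (P ∘ (inside ∷_)) ⊎ Sub (P ∘ (outside ∷_)))
Sub↔⊎ P = mk↔ₛ′ split join
  (λ { (inj₁ _) → refl ; (inj₂ _) → refl })
  (λ { (inside ∷ _ , _) → refl ; (outside ∷ _ , _) → refl })
  where
  split : Sub P → Sub (P ∘ (inside ∷_)) ⊎ Sub (P ∘ (outside ∷_))
  split (inside  ∷ s , p) = inj₁ (s , p)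
  split (outside ∷ s , p) = inj₂ (s , p)
  join : Sub (P ∘ (inside ∷_)) ⊎ Sub (P ∘ (outside ∷_)) → Sub P
  join (inj₁ (s , p)) = inside ∷ s , p
  join (inj₂ (s , p)) = outside ∷ s , p

Sub↔Fin : ∀ {n} (P : Subset n → Bool) → Sub P ↔ Fin (count P)
Sub↔Fin {zero}  P = T↔Fin (P []) ↔-∘ Sub↔T P
Sub↔Fin {suc n} P = ↔-sym +↔⊎ ↔-∘ ((Sub↔Fin _ ⊎-↔ Sub↔Fin _) ↔-∘ Sub↔⊎ P)

↣⇒≤ : ∀ {A B : Set} {m k} → A ↔ Fin m → B ↔ Fin k → A ↣ B → m ≤ k
↣⇒≤ A↔ B↔ A↣B =
  injective⇒≤ (Injection.injective (↔⇒↣ B↔ ↣-∘ (A↣B ↣-∘ ↔⇒↣ (↔-sym A↔))))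

⊤⊎↔Fin : ∀ {A : Set} {m} → A ↔ Fin m → (⊤ ⊎ A) ↔ Fin (suc m)
⊤⊎↔Fin A↔ = ↔-sym +↔⊎ ↔-∘ (↔-sym 1↔⊤ ⊎-↔ A↔)

count-mono : ∀ {n k} {P : Subset n → Bool} {Q : Subset k → Bool} →
             Sub P ↣ Sub Q → count P ≤ count Q
count-mono = ↣⇒≤ (Sub↔Fin _) (Sub↔Fin _)

count-< : ∀ {n k} {P : Subset n → Bool} {Q : Subset k → Bool} (g : Sub P ↣ Sub Q) (b : Sub Q) →
          (∀ a → Injection.to g a ≢ b) → count P < count Q
count-< g b missed = ↣⇒≤ (⊤⊎↔Fin (Sub↔Fin _)) (Sub↔Fin _) (mk↣ injective)
  where
  g⁺ : ⊤ ⊎ Sub _ → Sub _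
  g⁺ (inj₁ _) = b
  g⁺ (inj₂ a) = Injection.to g a
  injective : ∀ {x y} → g⁺ x ≡ g⁺ y → x ≡ y
  injective {inj₁ _} {inj₁ _} _ = refl
  injective {inj₁ _} {inj₂ a} e = ⊥-elim (missed a (sym e))
  injective {inj₂ a} {inj₁ _} e = ⊥-elim (missed a e)
  injective {inj₂ _} {inj₂ _} e = cong inj₂ (Injection.injective g e)

count-≤-suc : ∀ {n k} {P : Subset n → Bool} {Q : Subset k → Bool} →
              Sub P ↣ (⊤ ⊎ Sub Q) → count P ≤ suc (count Q)
count-≤-suc = ↣⇒≤ (Sub↔Fin _) (⊤⊎↔Fin (Sub↔Fin _))

anySub? : ∀ {n} {P : Subset n → Bool} {Q : Sub P → Set} → (∀ a → Dec (Q a)) → Dec (∃ Q)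
anySub? {P = P} {Q} Q? =
  map′ (λ (s , p , q) → (s , p) , q) (λ ((s , p) , q) → s , p , q) (anySubset? at)
  where
  at : ∀ s → Dec (Σ (T (P s)) λ p → Q (s , p))
  at s with T? (P s)
  ... | yes p = map′ (p ,_) (λ (p′ , q) → subst (λ p → Q (s , p)) (T-irrelevant p′ p) q) (Q? (s , p))
  ... | no ¬p = no (¬p ∘ proj₁)

allSub? : ∀ {n} {P : Subset n → Bool} {Q : Sub P → Set} → (∀ a → Dec (Q a)) → Dec (∀ a → Q a)
allSub? Q? = map′ (λ none a → decidable-stable (Q? a) (λ ¬q → none (a , ¬q)))
                  (λ all (a , ¬q) → ¬q (all a))
                  (¬? (anySub? (¬? ∘ Q?)))

least-element : ∀ {n} {P : Subset n → Set} → (∀ c → Dec (P c)) →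
                (∀ a b → P a → P b → P (a ∩ b)) →
                ∃ P → ∃[ m ] P m × (∀ c → P c → m ⊆ c)
least-element {P = P} P? closed (w , pw) = go (⊂-wellFounded w) pw
  where
  go : ∀ {w} → Acc _⊂_ w → P w → ∃[ m ] P m × (∀ c → P c → m ⊆ c)
  go {w} (acc smaller) pw
    with anySubset? (λ c → P? c ×-dec any? (λ x → x ∈? w ×-dec ¬? (x ∈? c)))
  ... | yes (c , pc , x , x∈w , x∉c) =
    go (smaller (p∩q⊆p w c , x , x∈w , x∉c ∘ proj₂ ∘ x∈p∩q⁻ w c)) (closed w c pw pc)
  ... | no none =
    w , pw , λ c pc {x} x∈w → decidable-stable (x ∈? c) (λ x∉c → none (c , pc , x , x∈w , x∉c))

module _ {n m} (X : Code n) (Y : Code m) (f : Elem X → Elem Y) where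

  Pullback : Subset n → Subset m → Set
  Pullback σ τ = ∀ (c : Elem X) → (σ ⊆ proj₁ c) ⇔ (τ ⊆ proj₁ (f c))

  pullback-proper : ∀ {σ τ} → Pullback σ τ → ProperTrunk X σ → ProperTrunk Y τ
  pullback-proper pb ((c , σ⊆c) , notAll) =
    (f c , Equivalence.to (pb c) σ⊆c) , λ all → notAll λ d → Equivalence.from (pb d) (all (f d))

SameTrunk : ∀ {n} → Code n → Subset n → Subset n → Set
SameTrunk X = Pullback X X id

module _ {n} (X : Code n) where

  properTrunk? : ∀ σ → Dec (ProperTrunk X σ)
  properTrunk? σ = anySub? (λ c → σ ⊆? proj₁ c) ×-dec ¬? (allSub? (λ c → σ ⊆? proj₁ c))

  everyCodewordAbove? : ∀ σ i → Dec (∀ (c : Elem X) → σ ⊆ proj₁ c → i ∈ proj₁ c)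
  everyCodewordAbove? σ i = allSub? λ c → σ ⊆? proj₁ c →-dec i ∈? proj₁ c

  -- the largest σ′ with Tk(σ′) = Tk(σ)
  closure : Subset n → Subset n
  closure σ = tabulate (⌊_⌋ ∘ everyCodewordAbove? σ)

  ∈-closure : ∀ {σ i} → i ∈ closure σ ⇔ (∀ (c : Elem X) → σ ⊆ proj₁ c → i ∈ proj₁ c)
  ∈-closure {σ} {i} = mk⇔
    (λ i∈ → toWitness (Equivalence.from T-≡ (trans (sym (lookup∘tabulate f i)) ([]=⇒lookup i∈))))
    (λ all → lookup⇒[]= i _ (trans (lookup∘tabulate f i) (Equivalence.to T-≡ (fromWitness all))))
    where f = ⌊_⌋ ∘ everyCodewordAbove? σ

  ⊆-closure : ∀ σ → σ ⊆ closure σ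
  ⊆-closure σ i∈σ = Equivalence.from (∈-closure {σ}) λ _ σ⊆c → σ⊆c i∈σ

  closure-⊆ : ∀ {σ} (c : Elem X) → σ ⊆ proj₁ c → closure σ ⊆ proj₁ c
  closure-⊆ {σ} c σ⊆c i∈ = Equivalence.to (∈-closure {σ}) i∈ c σ⊆c

  sameTrunk-closure : ∀ σ → SameTrunk X σ (closure σ)
  sameTrunk-closure σ c = mk⇔ (closure-⊆ c) (⊆-trans (⊆-closure σ))

  closure-cong : ∀ {σ τ} → SameTrunk X σ τ → closure σ ≡ closure τ
  closure-cong st = ⊆-antisym (mono st) (mono (λ c → ⇔-sym (st c)))
    where
    mono : ∀ {σ τ} → SameTrunk X σ τ → closure σ ⊆ closure τ
    mono {σ} {τ} st i∈ = Equivalence.from (∈-closure {τ}) λ c τ⊆c →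
      Equivalence.to (∈-closure {σ}) i∈ c (Equivalence.from (st c) τ⊆c)

  -- Proper trunks are counted through their closures, which determine them.
  isTrunkRep : Subset n → Bool
  isTrunkRep ρ = ⌊ properTrunk? ρ ⌋ ∧ ⌊ ≡-dec _≟ᵇ_ (closure ρ) ρ ⌋

  TrunkRep : Set
  TrunkRep = Sub isTrunkRep

  trunkCount : ℕ
  trunkCount = count isTrunkRep

  isTrunkRep⇔ : ∀ {ρ} → T (isTrunkRep ρ) ⇔ (ProperTrunk X ρ × closure ρ ≡ ρ)
  isTrunkRep⇔ {ρ} = mk⇔
    (λ t → let p , c = Equivalence.to both t in toWitness p , toWitness c)
    (λ (p , c) → Equivalence.from both (fromWitness p , fromWitness c))
    where both = T-∧ {⌊ properTrunk? ρ ⌋} {⌊ ≡-dec _≟ᵇ_ (closure ρ) ρ ⌋}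

  trunkRep : ∀ {σ} → ProperTrunk X σ → TrunkRep
  trunkRep {σ} pt = closure σ , Equivalence.from isTrunkRep⇔
    ( pullback-proper X X id (sameTrunk-closure σ) pt
    , closure-cong (λ c → ⇔-sym (sameTrunk-closure σ c)))

  trunkRep-proper : (r : TrunkRep) → ProperTrunk X (proj₁ r)
  trunkRep-proper r = proj₁ (Equivalence.to isTrunkRep⇔ (proj₂ r))

  sameTrunk⇒≡ : {r s : TrunkRep} → SameTrunk X (proj₁ r) (proj₁ s) → r ≡ s
  sameTrunk⇒≡ {r} {s} st = Sub-≡ (trans (sym (closed r)) (trans (closure-cong st) (closed s)))
    where
    closed : (r : TrunkRep) → closure (proj₁ r) ≡ proj₁ r
    closed r = proj₂ (Equivalence.to isTrunkRep⇔ (proj₂ r))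

  closure-≡⇒sameTrunk : ∀ {σ τ} → closure σ ≡ closure τ → SameTrunk X σ τ
  closure-≡⇒sameTrunk {σ} {τ} e c =
    ⇔-sym (sameTrunk-closure τ c) ⇔-∘ subst (SameTrunk X σ) e (sameTrunk-closure σ) c

module _ {n m} (X : Code n) (Y : Code m) (f : Elem X → Elem Y) where

  pullback-cong : ∀ {σ₁ σ₂ τ₁ τ₂} → Pullback X Y f σ₁ τ₁ → Pullback X Y f σ₂ τ₂ →
                  SameTrunk Y τ₁ τ₂ → SameTrunk X σ₁ σ₂
  pullback-cong pb₁ pb₂ st c = ⇔-sym (pb₂ c) ⇔-∘ (st (f c) ⇔-∘ pb₁ c)

  pullback-injective : Surjective X Y f → ∀ {σ₁ σ₂ τ₁ τ₂} →
                       Pullback X Y f σ₁ τ₁ → Pullback X Y f σ₂ τ₂ →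
                       SameTrunk X σ₁ σ₂ → SameTrunk Y τ₁ τ₂
  pullback-injective sur {τ₁ = τ₁} {τ₂} pb₁ pb₂ st d with c , fc≡d ← sur d =
    subst (λ e → (τ₁ ⊆ e) ⇔ (τ₂ ⊆ e)) fc≡d (pb₂ c ⇔-∘ (st c ⇔-∘ ⇔-sym (pb₁ c)))

  pullback-proper⁻ : Surjective X Y f → ∀ {σ τ} →
                     Pullback X Y f σ τ → ProperTrunk Y τ → ProperTrunk X σ
  pullback-proper⁻ sur {τ = τ} pb ((d , τ⊆d) , notAll) =
    (c , Equivalence.from (pb c) (subst (τ ⊆_) (sym fc≡d) τ⊆d)) ,
    λ all → notAll λ d′ → let c′ , fc′≡d′ = sur d′ in
      subst (τ ⊆_) fc′≡d′ (Equivalence.to (pb c′) (all c′))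
    where
    c = proj₁ (sur d)
    fc≡d = proj₂ (sur d)

  trunkCount≤suc : (ρ₀ : Subset n) →
    (∀ {σ} → ProperTrunk X σ → SameTrunk X σ ρ₀ ⊎ ∃[ τ ] ProperTrunk Y τ × Pullback X Y f σ τ) →
    trunkCount X ≤ suc (trunkCount Y)
  trunkCount≤suc ρ₀ classify =
    count-≤-suc (mk↣ {to = λ r → push r (classify (trunkRep-proper X r))} (push-injective _ _ _ _))
    where
    Kind : Subset n → Set
    Kind σ = SameTrunk X σ ρ₀ ⊎ ∃[ τ ] ProperTrunk Y τ × Pullback X Y f σ τ
    push : (r : TrunkRep X) → Kind (proj₁ r) → ⊤ ⊎ TrunkRep Y
    push r (inj₁ _)            = inj₁ tt
    push r (inj₂ (τ , pt , _)) = inj₂ (trunkRep Y pt)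
    push-injective : ∀ r s (kr : Kind (proj₁ r)) (ks : Kind (proj₁ s)) → push r kr ≡ push s ks → r ≡ s
    push-injective r s (inj₁ r~ρ₀) (inj₁ s~ρ₀) _ =
      sameTrunk⇒≡ X λ c → ⇔-sym (s~ρ₀ c) ⇔-∘ r~ρ₀ c
    push-injective r s (inj₂ (_ , _ , pb)) (inj₂ (_ , _ , pb′)) e =
      sameTrunk⇒≡ X (pullback-cong pb pb′ (closure-≡⇒sameTrunk Y (cong proj₁ (inj₂-injective e))))

module SurjectiveMorphism {n m} (X : Code n) (Y : Code m) (F : Y ≤ᶜ X) where

  f : Elem X → Elem Y
  f = proj₁ F

  private
    mor : IsMorphism X Y f
    mor = proj₁ (proj₂ F)

    sur : Surjective X Y f
    sur = proj₂ (proj₂ F)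

  pull : TrunkRep Y → TrunkRep X
  pull r = trunkRep X (proj₁ (proj₂ (mor (proj₁ r) (trunkRep-proper Y r))))

  pullback-pull : ∀ r → Pullback X Y f (proj₁ (pull r)) (proj₁ r)
  pullback-pull r c with τ , _ , pb ← mor (proj₁ r) (trunkRep-proper Y r) =
    pb c ⇔-∘ ⇔-sym (sameTrunk-closure X τ c)

  pull↣ : TrunkRep Y ↣ TrunkRep X
  pull↣ = mk↣ {to = pull} λ {r} {s} e → sameTrunk⇒≡ Y
    (pullback-injective X Y f sur (pullback-pull r) (pullback-pull s)
      (closure-≡⇒sameTrunk X (cong (closure X ∘ proj₁) e)))

  trunkCount-mono : trunkCount Y ≤ trunkCount X
  trunkCount-mono = count-mono pull↣

  everyTrunkPulledBack : trunkCount X ≤ trunkCount Y →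
                         ∀ {σ} → ProperTrunk X σ → ∃[ ρ ] ProperTrunk Y ρ × Pullback X Y f σ ρ
  everyTrunkPulledBack X≤Y {σ} pt
    with anySub? (λ r → ≡-dec _≟ᵇ_ (proj₁ (pull r)) (closure X σ))
  ... | no missed =
    ⊥-elim (<⇒≱ (count-< pull↣ (trunkRep X pt) (λ r → missed ∘ (r ,_) ∘ cong proj₁)) X≤Y)
  ... | yes (r , e) = proj₁ r , trunkRep-proper Y r , λ c →
    pullback-pull r c ⇔-∘ subst (SameTrunk X σ) (sym e) (sameTrunk-closure X σ) c

  trunkCount≤⇒injective : trunkCount X ≤ trunkCount Y →
                          ∀ u v → proj₁ (f u) ≡ proj₁ (f v) → proj₁ u ≡ proj₁ v
  trunkCount≤⇒injective X≤Y u v e = ⊆-antisym (separate u v e) (separate v u (sym e))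
    where
    separate : ∀ u v → proj₁ (f u) ≡ proj₁ (f v) → proj₁ u ⊆ proj₁ v
    separate u v e = decidable-stable (proj₁ u ⊆? proj₁ v) λ u⊈v →
      let ρ , _ , pb = everyTrunkPulledBack X≤Y ((u , id) , λ all → u⊈v (all v))
      in u⊈v (Equivalence.from (pb v) (subst (ρ ⊆_) e (Equivalence.to (pb u) id)))

  trunkCount≤⇒Iso : trunkCount X ≤ trunkCount Y → Iso X Y
  trunkCount≤⇒Iso X≤Y = f , g , mor , gmor , gf , fg
    where
    g : Elem Y → Elem X
    g d = proj₁ (sur d)
    fg : ∀ d → proj₁ (f (g d)) ≡ proj₁ d
    fg d = proj₂ (sur d)
    gf : ∀ c → proj₁ (g (f c)) ≡ proj₁ c
    gf c = trunkCount≤⇒injective X≤Y (g (f c)) c (fg (f c))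
    gmor : IsMorphism Y X g
    gmor σ pt with ρ , ρ-proper , pb ← everyTrunkPulledBack X≤Y pt =
      ρ , ρ-proper , λ d → subst (λ e → (ρ ⊆ e) ⇔ (σ ⊆ proj₁ (g d))) (fg d) (⇔-sym (pb (g d)))

Iso⇒≥ᶜ : ∀ {n m} {X : Code n} {Y : Code m} → Iso X Y → X ≤ᶜ Y
Iso⇒≥ᶜ (_ , g , _ , gmor , gf , _) = g , gmor , λ c → _ , gf c

module Extension {n} (C : Code n) (I : Subset n → Bool) (μ : Subset n) (isol : IsIsolated C I μ) where

  private
    I⊆C : ∀ c → T (I c) → T (mem C c)
    I⊆C = proj₁ isol
    I-∩ : ∀ a b → T (I a) → T (I b) → T (I (a ∩ b))
    I-∩ = proj₁ (proj₂ (proj₂ isol))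
    μ∈I : T (I μ)
    μ∈I = proj₁ (proj₁ (proj₂ (proj₂ (proj₂ isol))))
    μ-least : ∀ c → T (I c) → μ ⊆ c
    μ-least = proj₂ (proj₁ (proj₂ (proj₂ (proj₂ isol))))
    isolated : ¬ (∃[ σ ] ∃[ τ ] (T (mem C σ) × ¬ T (I σ) × T (I τ) × τ ≢ μ × τ ⊆ σ))
    isolated = proj₂ (proj₂ (proj₂ (proj₂ isol)))

  C′ : Code (suc n)
  C′ = extend C I μ isol

  ∈C′-outside : ∀ c → T (mem C′ (outside ∷ c)) ⇔ (c ≡ μ ⊎ T (mem C c) × ¬ T (I c))
  ∈C′-outside c with ≡-dec _≟ᵇ_ c μ
  ... | yes c≡μ = mk⇔ (λ _ → inj₁ c≡μ) _
  ... | no c≢μ with mem C c | I c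
  ...   | true  | false = mk⇔ (λ _ → inj₂ (_ , λ ())) _
  ...   | true  | true  = mk⇔ (λ ()) [ c≢μ , (λ (_ , ∉I) → ∉I _) ]′
  ...   | false | _     = mk⇔ (λ ()) [ c≢μ , proj₁ ]′

  inside⊈outside : ∀ {σ c : Subset n} → ¬ (inside ∷ σ ⊆ outside ∷ c)
  inside⊈outside h with h here
  ... | ()

  dropα-∈ : ∀ {b c} → T (mem C′ (b ∷ c)) → T (mem C c)
  dropα-∈ {inside}  {c} = I⊆C c
  dropα-∈ {outside} {c} p with Equivalence.to (∈C′-outside c) p
  ... | inj₁ refl      = I⊆C μ μ∈I
  ... | inj₂ (c∈C , _) = c∈C

  dropα : Elem C′ → Elem C
  dropα (b ∷ c , p) = c , dropα-∈ {b} p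

  liftα : ∀ {c} → T (mem C c) → ∃[ b ] T (mem C′ (b ∷ c))
  liftα {c} c∈C with T? (I c)
  ... | yes c∈I = inside , c∈I
  ... | no c∉I  = outside , Equivalence.from (∈C′-outside c) (inj₂ (c∈C , c∉I))

  dropα-surjective : Surjective C′ C dropα
  dropα-surjective (c , c∈C) = (proj₁ (liftα c∈C) ∷ c , proj₂ (liftα c∈C)) , refl

  pullback-outside : ∀ σ → Pullback C′ C dropα (outside ∷ σ) σ
  pullback-outside σ (_ ∷ c , _) = ⇔-sym out⊆-⇔

  dropα-morphism : IsMorphism C′ C dropα
  dropα-morphism σ pt =
    outside ∷ σ ,
    pullback-proper⁻ C′ C dropα dropα-surjective (pullback-outside σ) pt ,
    pullback-outside σ

  dropα-≤ᶜ : C ≤ᶜ C′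
  dropα-≤ᶜ = dropα , dropα-morphism , dropα-surjective

  α-trunk : ∀ {σ} → σ ⊆ μ → SameTrunk C′ (inside ∷ σ) (inside ∷ μ)
  α-trunk {σ} σ⊆μ (inside ∷ c , c∈I) =
    mk⇔ {A = inside ∷ σ ⊆ inside ∷ c} {B = inside ∷ μ ⊆ inside ∷ c}
        (const (above ⊆-refl)) (const (above σ⊆μ))
    where
    above : ∀ {σ′} → σ′ ⊆ μ → inside ∷ σ′ ⊆ inside ∷ c
    above σ′⊆μ = in⊆in (⊆-trans σ′⊆μ (μ-least c c∈I))
  α-trunk σ⊆μ (outside ∷ c , _) = mk⇔ (⊥-elim ∘ inside⊈outside) (⊥-elim ∘ inside⊈outside)

  pullback-inside : ∀ {σ} → ¬ σ ⊆ μ → ProperTrunk C′ (inside ∷ σ) →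
                    ∃[ τ ] Pullback C′ C dropα (inside ∷ σ) τ
  pullback-inside σ⊈μ (((outside ∷ c , _) , h) , _) = ⊥-elim (inside⊈outside h)
  pullback-inside {σ} σ⊈μ (((inside ∷ w , w∈I) , h) , _) = τ , pb
    where
    Above : Subset n → Set
    Above c = T (I c) × σ ⊆ c

    least : ∃[ τ ] Above τ × (∀ c → Above c → τ ⊆ c)
    least = least-element (λ c → T? (I c) ×-dec σ ⊆? c)
      (λ a b (a∈I , σ⊆a) (b∈I , σ⊆b) →
        I-∩ a b a∈I b∈I , λ x∈σ → x∈p∩q⁺ (σ⊆a x∈σ , σ⊆b x∈σ))
      (w , w∈I , drop-∷-⊆ h)

    τ = proj₁ least
    τ∈I = proj₁ (proj₁ (proj₂ least))
    σ⊆τ = proj₂ (proj₁ (proj₂ least))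
    τ-least = proj₂ (proj₂ least)

    τ≢μ : τ ≢ μ
    τ≢μ τ≡μ = σ⊈μ (subst (σ ⊆_) τ≡μ σ⊆τ)

    -- isolation of I is exactly what keeps codewords without α out of Tk_C(τ)
    τ⊈ : ∀ c → T (mem C′ (outside ∷ c)) → ¬ τ ⊆ c
    τ⊈ c p τ⊆c with Equivalence.to (∈C′-outside c) p
    ... | inj₁ refl        = τ≢μ (⊆-antisym τ⊆c (μ-least τ τ∈I))
    ... | inj₂ (c∈C , c∉I) = isolated (c , τ , c∈C , c∉I , τ∈I , τ≢μ , τ⊆c)

    pb : Pullback C′ C dropα (inside ∷ σ) τ
    pb (inside ∷ c , c∈I) = mk⇔ above-σ⇒above-τ (⊆-trans σ⊆τ) ⇔-∘ ⇔-sym in⊆in-⇔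
      where
      above-σ⇒above-τ : σ ⊆ c → τ ⊆ c
      above-σ⇒above-τ σ⊆c = τ-least c (c∈I , σ⊆c)
    pb (outside ∷ c , p)  = mk⇔ (⊥-elim ∘ inside⊈outside) (⊥-elim ∘ τ⊈ c p)

  trunk-of-C′ : ∀ {ρ} → ProperTrunk C′ ρ →
                SameTrunk C′ ρ (inside ∷ μ) ⊎ ∃[ τ ] ProperTrunk C τ × Pullback C′ C dropα ρ τ
  trunk-of-C′ {outside ∷ σ} pt =
    inj₂ (σ , pullback-proper C′ C dropα (pullback-outside σ) pt , pullback-outside σ)
  trunk-of-C′ {inside ∷ σ} pt with σ ⊆? μ
  ... | yes σ⊆μ = inj₁ (α-trunk σ⊆μ)
  ... | no σ⊈μ  = let τ , pb = pullback-inside σ⊈μ pt in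
                  inj₂ (τ , pullback-proper C′ C dropα pb pt , pb)

  trunkCount-C′≤ : trunkCount C′ ≤ suc (trunkCount C)
  trunkCount-C′≤ = trunkCount≤suc C′ C dropα (inside ∷ μ) trunk-of-C′

  trunkCount-C< : trunkCount C < trunkCount C′
  trunkCount-C< = ≰⇒> λ C′≤C →
    αμ≢μ (SurjectiveMorphism.trunkCount≤⇒injective C′ C dropα-≤ᶜ C′≤C
           (inside ∷ μ , μ∈I) (outside ∷ μ , Equivalence.from (∈C′-outside μ) (inj₁ refl)) refl)
    where
    αμ≢μ : inside ∷ μ ≢ outside ∷ μ
    αμ≢μ ()

one-more-trunk⇒Covers : ∀ {n m} {C : Code n} {D : Code m} → D ≤ᶜ C →
                        trunkCount D < trunkCount C → trunkCount C ≤ suc (trunkCount D) →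
                        Covers C D
one-more-trunk⇒Covers {C = C} {D} D≤C D<C C≤1+D = (D≤C , C≇D) , nothingBetween
  where
  C≇D : ¬ Iso C D
  C≇D iso = <⇒≱ D<C (SurjectiveMorphism.trunkCount-mono D C (Iso⇒≥ᶜ {X = C} {Y = D} iso))

  nothingBetween : ∀ k (E : Code k) → ¬ (D <ᶜ E × E <ᶜ C)
  nothingBetween _ E ((D≤E , E≇D) , (E≤C , C≇E)) with trunkCount E ≤? trunkCount D
  ... | yes E≤D = E≇D (SurjectiveMorphism.trunkCount≤⇒Iso E D D≤E E≤D)
  ... | no  E≰D = C≇E (SurjectiveMorphism.trunkCount≤⇒Iso C E E≤C (≤-trans C≤1+D (≰⇒> E≰D)))

proposition36 : ∀ (n : ℕ) (C : Code n) (I : Subset n → Bool) (μ : Subset n) →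
    IntersectionComplete C → (iso : IsIsolated C I μ) →
    Covers (extend C I μ iso) C
proposition36 n C I μ _ isol =
  one-more-trunk⇒Covers {C = C′} {D = C} dropα-≤ᶜ trunkCount-C< trunkCount-C′≤
  where open Extension C I μ isol
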